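{- Every normal form $t\in\Lambda^{001}$ admits an unforgetful derivation, i.e. there exist a context $C$, a type $T$ and a derivation $P\rhd C\vdash t:T$ such that $\mathrm{EFO}^-(C(x))=\emptyset$ for every variable $x$ and $\mathrm{EFO}^+(T)=\emptyset$.
   Context: Sequences: $\mathbb{N}^*$ finite sequences of naturals, $\varepsilon$ empty, $\cdot$ concatenation. Terms: $\Lambda^{111}$ = possibly infinite $\lambda$-terms $t,u::=x\mid\lambda x.t\mid tu$ (coinductive, up to $\alpha$-equivalence), identified with parsing trees: $\mathrm{supp}(x)=\{\varepsilon\}$, $\mathrm{supp}(\lambda x.t)=\{\varepsilon\}\cup0\cdot\mathrm{supp}(t)$, $\mathrm{supp}(tu)=\{\varepsilon\}\cup1\cdot\mathrm{supp}(t)\cup2\cdot\mathrm{supp}(u)$. $\Lambda^{001}$: terms every infinite branch of whose support has infinitely many entries $2$. A normal form is a term containing no subterm of the form $(\lambda x.r)s$. Types: mutually coinductive $T::=\alpha\mid F\to T$, $F::=(T_k)_{k\in K}$, $K\subseteq\mathbb{N}\setminus\{0,1\}$, syntactic equality; $\mathrm{supp}(\alpha)=\{\varepsilon\}$, $\mathrm{supp}(F\to T)=\{\varepsilon\}\cup\mathrm{supp}(F)\cup1\cdot\mathrm{supp}(T)$, $\mathrm{supp}((T_k)_k)=\bigcup_kk\cdot\mathrm{supp}(T_k)$, no infinite branch ending in $1^\omega$. $()$ empty sequence type; $k\cdot T$ single component $T$ at index $k$; disjoint sequence types (disjoint index sets) have a join collecting all components. Contexts map variables to sequence types; $C-x$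 resets $x$ to $()$; joins pointwise. Derivations: possibly infinite trees of judgments $C\vdash t:T$ generated coinductively by (ax) $x:k\cdot T\vdash x:T$, $k\ge2$; (abs) from $C\vdash t:T$ infer $C-x\vdash\lambda x.t:C(x)\to T$; (app) from $C\vdash t:(S_k)_{k\in K}\to T$ and for each $k\in K$ a premise $D_k\vdash u:S_k$, infer $C\cup\bigcup_kD_k\vdash tu:T$, with $C$ and the $D_k$ pairwise disjoint. $\mathrm{EFO}^\pm$ are defined by mutual coinduction ($\mp$ the opposite polarity): $\mathrm{EFO}^\pm(\alpha)=\emptyset$; $\mathrm{EFO}^-(()\to T)=\{\varepsilon\}\cup1\cdot\mathrm{EFO}^-(T)$, $\mathrm{EFO}^+(()\to T)=1\cdot\mathrm{EFO}^+(T)$; for $F\ne()$, $\mathrm{EFO}^\pm(F\to T)=\mathrm{EFO}^\mp(F)\cup1\cdot\mathrm{EFO}^\pm(T)$; $\mathrm{EFO}^\pm((T_k)_{k\in K})=\bigcup_kk\cdot\mathrm{EFO}^\pm(T_k)$. -}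

module Defs where

-- Possibly infinite lambda-terms, types and derivations are represented, as in the
-- paper, by their (labelled) parsing trees: partial labellings of positions in N*.

open import Data.Nat using (ℕ; zero; suc; _≤_; _≟_)
open import Data.List using (List; []; _∷_; _++_; replicate; applyUpTo)
open import Data.Maybe using (Maybe; just; nothing)
open import Data.Product using (Σ; _×_; _,_; ∃)
open import Data.Sum using (_⊎_)
open import Data.Empty using (⊥)
open import Data.Unit using (⊤)
open import Data.Bool using (if_then_else_)
open import Relation.Nullary using (¬_)
open import Relation.Nullary.Decidable using (⌊_⌋)
open import Relation.Binary.PropositionalEquality using (_≡_; _≢_; refl)

Pos : Set
Pos = List ℕ

_·_ : Pos → ℕ → Pos
p · k = p ++ (k ∷ [])

LTree : Set → Set
LTree L = Pos → Maybe L

sub : {L : Set} → LTree L → Pos → LTree L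
sub t p q = t (p ++ q)

_≈_ : {L : Set} → LTree L → LTree L → Set
t ≈ u = ∀ q → t q ≡ u q

prefix : (ℕ → ℕ) → ℕ → Pos
prefix b n = applyUpTo b n

data TmLabel : Set where
  var : ℕ → TmLabel
  lam : ℕ → TmLabel
  app : TmLabel

record Term : Set where
  field
    tree    : LTree TmLabel
    root    : tree [] ≢ nothing
    closed  : ∀ p k → tree p ≡ nothing → tree (p · k) ≡ nothing
    varLeaf : ∀ p x k → tree p ≡ just (var x) → tree (p · k) ≡ nothing
    lamBody : ∀ p x → tree p ≡ just (lam x) → tree (p · 0) ≢ nothing
    lamOnly : ∀ p x k → tree p ≡ just (lam x) → k ≢ 0 → tree (p · k) ≡ nothing
    appFun  : ∀ p → tree p ≡ just app → tree (p · 1) ≢ nothing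
    appArg  : ∀ p → tree p ≡ just app → tree (p · 2) ≢ nothing
    appOnly : ∀ p k → tree p ≡ just app → k ≢ 1 → k ≢ 2 → tree (p · k) ≡ nothing
open Term public

InΛ001 : Term → Set
InΛ001 t = ∀ (b : ℕ → ℕ) → (∀ n → tree t (prefix b n) ≢ nothing) →
           ∀ n → ∃ λ m → n ≤ m × b m ≡ 2

IsNormal : Term → Set
IsNormal t = ∀ p x → tree t p ≡ just app → tree t (p · 1) ≢ just (lam x)

-- Types: T ::= α | F → T, F = (T_k)_{k∈K}, K ⊆ N \ {0,1}
-- A node labelled arrow has its target at child 1 and the components of its
-- source sequence type at children k ≥ 2 (child 0 is never used).

data TyLabel : Set where
  atom  : ℕ → TyLabel
  arrow : TyLabel

record Ty : Set where
  field
    tree      : LTree TyLabel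
    root      : tree [] ≢ nothing
    closed    : ∀ p k → tree p ≡ nothing → tree (p · k) ≡ nothing
    atomLeaf  : ∀ p a k → tree p ≡ just (atom a) → tree (p · k) ≡ nothing
    arrowTgt  : ∀ p → tree p ≡ just arrow → tree (p · 1) ≢ nothing
    arrowNo0  : ∀ p → tree p ≡ just arrow → tree (p · 0) ≡ nothing
    no1ω      : ∀ p → ¬ (∀ n → tree (p ++ replicate n 1) ≢ nothing)
open Ty public

record SeqTy : Set where
  field
    comp  : ℕ → Maybe Ty
    comp0 : comp 0 ≡ nothing
    comp1 : comp 1 ≡ nothing
open SeqTy public

emptySeq : SeqTy
emptySeq = record { comp = λ _ → nothing ; comp0 = refl ; comp1 = refl }

_≈M_ : Maybe Ty → Maybe Ty → Set
nothing ≈M nothing = ⊤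
just S  ≈M just T  = tree S ≈ tree T
_       ≈M _       = ⊥

_≈S_ : SeqTy → SeqTy → Set
F ≈S G = ∀ k → comp F k ≈M comp G k

IsSingle : ℕ → Ty → SeqTy → Set
IsSingle k T F = ∀ j → comp F j ≈M (if ⌊ j ≟ k ⌋ then just T else nothing)

CompIs : LTree TyLabel → ℕ → Maybe Ty → Set
CompIs T k nothing  = T (k ∷ []) ≡ nothing
CompIs T k (just S) = ∀ q → T (k ∷ q) ≡ tree S q

IsArrow : SeqTy → Ty → Ty → Set
IsArrow F S T = tree T [] ≡ just arrow
              × (∀ q → tree T (1 ∷ q) ≡ tree S q)
              × (∀ k → 2 ≤ k → CompIs (tree T) k (comp F k))

Ctx : Set
Ctx = ℕ → SeqTy

_≈C_ : Ctx → Ctx → Set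
C ≈C D = ∀ x → C x ≈S D x

_-_ : Ctx → ℕ → Ctx
(C - x) y = if ⌊ y ≟ x ⌋ then emptySeq else C y

-- The premise of (abs) sits at child 0, the premise for the function in (app)
-- at child 1 and the premise D_k ⊢ u : S_k of (app) at child k (k ∈ K).

record Judg : Set where
  constructor _⊢_∶_
  field
    ctx  : Ctx
    tm   : LTree TmLabel
    ty   : Ty
open Judg public

module _ (node : Pos → Maybe Judg) (p : Pos) (J : Judg) where

  AxRule : Set
  AxRule = Σ ℕ λ x → tm J [] ≡ just (var x)
         × (Σ ℕ λ k → 2 ≤ k × IsSingle k (ty J) (ctx J x))
         × (∀ y → y ≢ x → ctx J y ≈S emptySeq)
         × (∀ k → node (p · k) ≡ nothing)

  AbsRule : Set
  AbsRule = Σ ℕ λ x → tm J [] ≡ just (lam x)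
          × (Σ Judg λ J' → node (p · 0) ≡ just J'
              × tm J' ≈ sub (tm J) (0 ∷ [])
              × ctx J ≈C (ctx J' - x)
              × IsArrow (ctx J' x) (ty J') (ty J))
          × (∀ k → k ≢ 0 → node (p · k) ≡ nothing)

  ArgPremise : Ty → ℕ → Set
  ArgPremise Tf k =
      (tree Tf (k ∷ []) ≡ nothing × node (p · k) ≡ nothing)
    ⊎ (Σ Judg λ Jk → node (p · k) ≡ just Jk
         × tm Jk ≈ sub (tm J) (2 ∷ [])
         × (∀ q → tree Tf (k ∷ q) ≡ tree (ty Jk) q))

  PremisesDisjoint : Set
  PremisesDisjoint = ∀ i i' Ji Ji' → i ≢ i' →
    node (p · i) ≡ just Ji → node (p · i') ≡ just Ji' →
    ∀ x j → comp (ctx Ji x) j ≡ nothing ⊎ comp (ctx Ji' x) j ≡ nothing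

  IsJoinOfPremises : Set
  IsJoinOfPremises = ∀ x j →
      (∀ i Ji → node (p · i) ≡ just Ji → comp (ctx Ji x) j ≢ nothing →
         comp (ctx J x) j ≈M comp (ctx Ji x) j)
    × (comp (ctx J x) j ≢ nothing →
         Σ ℕ λ i → Σ Judg λ Ji → node (p · i) ≡ just Ji × comp (ctx Ji x) j ≢ nothing)

  AppRule : Set
  AppRule = tm J [] ≡ just app
          × (Σ Judg λ J1 → node (p · 1) ≡ just J1
              × tm J1 ≈ sub (tm J) (1 ∷ [])
              × tree (ty J1) [] ≡ just arrow
              × (∀ q → tree (ty J1) (1 ∷ q) ≡ tree (ty J) q)
              × (∀ k → 2 ≤ k → ArgPremise (ty J1) k))
          × node (p · 0) ≡ nothing
          × PremisesDisjoint
          × IsJoinOfPremises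

  Rule : Set
  Rule = AxRule ⊎ AbsRule ⊎ AppRule

record Deriv : Set where
  field
    node   : Pos → Maybe Judg
    root   : node [] ≢ nothing
    closed : ∀ p k → node p ≡ nothing → node (p · k) ≡ nothing
    rule   : ∀ p J → node p ≡ just J → Rule node p J
open Deriv public

-- EFO^±, membership of a position, by recursion on the position
-- (this is the unique solution of the paper's mutually coinductive equations).

data Pol : Set where
  pos neg : Pol

flip : Pol → Pol
flip pos = neg
flip neg = pos

EmptySource : LTree TyLabel → Set
EmptySource T = ∀ k → 2 ≤ k → T (k ∷ []) ≡ nothing

EFO : Pol → LTree TyLabel → Pos → Set
EFO pos T []                  = ⊥
EFO neg T []                  = T [] ≡ just arrow × EmptySource T
EFO π   T (zero ∷ q)          = ⊥
EFO π   T (suc zero ∷ q)      = T [] ≡ just arrow × EFO π (sub T (1 ∷ [])) q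
EFO π   T (suc (suc k) ∷ q)   = T [] ≡ just arrow × EFO (flip π) (sub T (suc (suc k) ∷ [])) q

EFOnegEmptySeq : SeqTy → Set
EFOnegEmptySeq F = ∀ k S → comp F k ≡ just S → ∀ q → ¬ EFO neg (tree S) q

Unforgetful : Deriv → Term → Set
Unforgetful P t = Σ Judg λ J → node P [] ≡ just J
                × tm J ≈ tree t
                × (∀ x → EFOnegEmptySeq (ctx J x))
                × (∀ q → ¬ EFO pos (tree (ty J)) q)

-- Each subterm is typed according to its position in t. An abstraction λx.u gets the arrow from the
-- sequence of the types of the free occurrences of x in u (the occurrence at r sitting at index 2 + encode r)
-- to the type of u; the function part of an application gets (2 · type of the argument) → (type of the
-- application); every other subterm gets an atom. Contexts collect the types of free occurrences, so the
-- rules hold locally, and premises have disjoint contexts because they contain disjoint sets of positions.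
-- By mutual induction along the type, EFO⁺ is empty for subterms that are not function parts and EFO⁻ for
-- variables and applications (the source of a function part is never ()); this covers the root and the
-- contexts. Finally, an infinite target branch 1^ω would climb a finite application spine and then descend
-- forever through abstraction bodies, giving a branch of t ending in 0^ω, which Λ^001 excludes.

module Submission where

open import Defs
open import Data.Nat using (ℕ; zero; suc; _+_; _≤_; z≤n; s≤s; _≟_)
open import Data.Nat.Properties using (+-suc; +-comm; +-identityʳ; suc-injective; ≤-trans; ≤-refl; m≤m+n; m≤n+m)
open import Data.List using (List; []; _∷_; _++_; _∷ʳ_; replicate; length; initLast; _∷ʳ′_)
open import Data.List.Properties using (++-identityʳ; ++-assoc; ∷-injectiveˡ; ∷-injectiveʳ; ++-cancelˡ; ++-identityʳ-unique)
open import Data.Maybe as Maybe using (Maybe; just; nothing; maybe′)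
open import Data.Maybe.Properties using (just-injective)
open import Data.Bool using (if_then_else_)
open import Data.Empty using (⊥-elim)
open import Data.Product using (Σ; ∃; ∃₂; _×_; _,_; proj₁; proj₂)
open import Data.Sum using (_⊎_; inj₁; inj₂)
open import Function using (_∘_)
open import Relation.Nullary using (¬_; Dec; yes; no; map′; _×-dec_)
open import Relation.Nullary.Decidable using (⌊_⌋)
open import Relation.Unary using (Decidable)
open import Relation.Binary.PropositionalEquality

-- Encoding positions by natural numbers

triangle : ℕ → ℕ
triangle zero    = zero
triangle (suc d) = suc d + triangle d

n≤triangle : ∀ n → n ≤ triangle n
n≤triangle zero    = z≤n
n≤triangle (suc n) = m≤m+n (suc n) (triangle n)

-- Cantor pairing: (a , b) sits at place a of the a + b'th diagonal.
pair : ℕ → ℕ → ℕ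
pair a b = triangle (a + b) + a

next : ℕ × ℕ → ℕ × ℕ
next (a , suc b) = (suc a , b)
next (a , zero)  = (zero , suc a)

unpair : ℕ → ℕ × ℕ
unpair zero    = (0 , 0)
unpair (suc n) = next (unpair n)

pair-suc-zero : ∀ d → pair 0 (suc d) ≡ suc (pair d 0)
pair-suc-zero d rewrite +-identityʳ d =
  cong suc (trans (+-identityʳ (d + triangle d)) (+-comm d (triangle d)))

pair-suc-suc : ∀ a b → pair (suc a) b ≡ suc (pair a (suc b))
pair-suc-suc a b rewrite +-suc a b = +-suc (triangle (suc (a + b))) a

unpair-pair : ∀ a b → unpair (pair a b) ≡ (a , b)
unpair-pair a b = on-diagonal (a + b) a b refl
  where
  on-diagonal : ∀ d a b → a + b ≡ d → unpair (pair a b) ≡ (a , b)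
  on-diagonal d (suc a) b e =
    trans (cong unpair (pair-suc-suc a b)) (cong next (on-diagonal d a (suc b) (trans (+-suc a b) e)))
  on-diagonal zero zero zero e = refl
  on-diagonal (suc d) zero (suc b) e =
    trans (cong unpair (pair-suc-zero b))
          (cong next (on-diagonal d b 0 (trans (+-identityʳ b) (suc-injective e))))

snd≤pair : ∀ a b → b ≤ pair a b
snd≤pair a b = ≤-trans (m≤n+m b a) (≤-trans (n≤triangle (a + b)) (m≤m+n _ a))

encode : List ℕ → ℕ
encode []      = 0
encode (a ∷ r) = suc (pair a (encode r))

-- the fuel argument bounds the recursion, since each tail has a smaller code
decodeWithin : ℕ → ℕ → List ℕ
decodeWithin zero    _       = []
decodeWithin (suc f) zero    = []
decodeWithin (suc f) (suc n) = proj₁ (unpair n) ∷ decodeWithin f (proj₂ (unpair n))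

decode : ℕ → List ℕ
decode n = decodeWithin n n

decode-encode : ∀ r → decode (encode r) ≡ r
decode-encode r = within r (encode r) ≤-refl
  where
  within : ∀ r f → encode r ≤ f → decodeWithin f (encode r) ≡ r
  within []      zero    _         = refl
  within []      (suc f) _         = refl
  within (a ∷ r) (suc f) (s≤s le) rewrite unpair-pair a (encode r) =
    cong (a ∷_) (within r f (≤-trans (snd≤pair a (encode r)) le))

encode-injective : ∀ {r r'} → encode r ≡ encode r' → r ≡ r'
encode-injective {r} {r'} e = trans (sym (decode-encode r)) (trans (cong decode e) (decode-encode r'))

-- The positions satisfying P, listed at the indices 2 + encode r, as components of a sequence type.
select : {P : Pos → Set} → Decidable P → ℕ → Maybe Pos
select P? zero          = nothing
select P? (suc zero)    = nothing
select P? (suc (suc n)) with encode (decode n) ≟ n ×-dec P? (decode n)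
... | yes _ = just (decode n)
... | no _  = nothing

select-just : ∀ {P} (P? : Decidable P) j {r} → select P? j ≡ just r → P r × j ≡ suc (suc (encode r))
select-just P? (suc (suc n)) e with encode (decode n) ≟ n ×-dec P? (decode n)
select-just P? (suc (suc n)) refl | yes (enc , pr) = pr , cong (λ m → suc (suc m)) (sym enc)

select-encode : ∀ {P} (P? : Decidable P) {r} → P r → select P? (suc (suc (encode r))) ≡ just r
select-encode P? {r} pr with encode (decode (encode r)) ≟ encode r ×-dec P? (decode (encode r))
... | yes _     = cong just (decode-encode r)
... | no ¬both rewrite decode-encode r = ⊥-elim (¬both (refl , pr))

select-none : ∀ {P} (P? : Decidable P) → (∀ {r} → ¬ P r) → ∀ j → select P? j ≡ nothing
select-none P? none j with select P? j in e
... | nothing = refl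
... | just r  = ⊥-elim (none (proj₁ (select-just P? j e)))

select-transfer : ∀ {P Q} (P? : Decidable P) (Q? : Decidable Q) j {r} →
                  select P? j ≡ just r → Q r → select Q? j ≡ just r
select-transfer P? Q? j e qr with select-just P? j e
... | _ , refl = select-encode Q? qr

select-cong : ∀ {P Q} (P? : Decidable P) (Q? : Decidable Q) →
              (∀ {r} → P r → Q r) → (∀ {r} → Q r → P r) → ∀ j → select P? j ≡ select Q? j
select-cong P? Q? P⇒Q Q⇒P j with select P? j in eP
... | just r = sym (select-transfer P? Q? j eP (P⇒Q (proj₁ (select-just P? j eP))))
... | nothing with select Q? j in eQ
...   | nothing = refl
...   | just r with () ← trans (sym eP) (select-transfer Q? P? j eQ (Q⇒P (proj₁ (select-just Q? j eQ))))

just≢nothing : ∀ {A : Set} {a : A} → just a ≢ nothing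
just≢nothing ()

map-just : ∀ {A B : Set} {f : A → B} m → Maybe.map f m ≢ nothing → ∃ λ a → m ≡ just a
map-just (just a) _  = a , refl
map-just nothing  ne = ⊥-elim (ne refl)

≈M-reflexive : ∀ {m m′} → m ≡ m′ → m ≈M m′
≈M-reflexive {nothing} refl = _
≈M-reflexive {just S}  refl = λ q → refl

length-· : ∀ s k → length (s · k) ≡ suc (length s)
length-· []      k = refl
length-· (c ∷ s) k = cong suc (length-· s k)

module Unfold {S L : Set} (label : S → L) (step : S → ℕ → Maybe S) where

  mutual
    unfold : S → LTree L
    unfold s []      = just (label s)
    unfold s (k ∷ q) = unfoldFrom (step s k) q

    unfoldFrom : Maybe S → LTree L
    unfoldFrom nothing  q = nothing
    unfoldFrom (just s) q = unfold s q

  unfold-gap : ∀ s q → unfold s q ≡ nothing → ∀ r → unfold s (q ++ r) ≡ nothing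
  unfold-gap s []      e r = ⊥-elim (just≢nothing e)
  unfold-gap s (k ∷ q) e r with step s k
  ... | nothing = refl
  ... | just s′ = unfold-gap s′ q e r

  unfold-reach : ∀ s q → unfold s q ≢ nothing → Σ S λ s′ → ∀ r → unfold s (q ++ r) ≡ unfold s′ r
  unfold-reach s []      _  = s , λ r → refl
  unfold-reach s (k ∷ q) ne with step s k
  ... | nothing = ⊥-elim (ne refl)
  ... | just s′ = unfold-reach s′ q ne

  unfold-local : ∀ s q {l} → unfold s q ≡ just l →
                 Σ S λ s′ → label s′ ≡ l × (∀ k → unfold s (q · k) ≡ unfoldFrom (step s′ k) [])
  unfold-local s q e with unfold-reach s q (λ e′ → just≢nothing (trans (sym e) e′))
  ... | s′ , rest = s′ , just-injective (trans (sym (rest [])) (trans (cong (unfold s) (++-identityʳ q)) e))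
                       , λ k → rest (k ∷ [])

  Infinite1Branch : S → Set
  Infinite1Branch s = ∀ n → unfold s (replicate n 1) ≢ nothing

  infinite1Branch-step : ∀ s → Infinite1Branch s → Σ S λ s′ → step s 1 ≡ just s′ × Infinite1Branch s′
  infinite1Branch-step s inf = from (step s 1) (λ n → inf (suc n))
    where
    from : ∀ m → (∀ n → unfoldFrom m (replicate n 1) ≢ nothing) → Σ S λ s′ → m ≡ just s′ × Infinite1Branch s′
    from nothing  inf′ = ⊥-elim (inf′ 0 refl)
    from (just s′) inf′ = s′ , refl , inf′

  unfold-no1ω : (∀ s → ¬ Infinite1Branch s) → ∀ s p → ¬ (∀ n → unfold s (p ++ replicate n 1) ≢ nothing)
  unfold-no1ω fin s p inf with unfold-reach s p (λ e → inf 0 (trans (cong (unfold s) (++-identityʳ p)) e))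
  ... | s′ , rest = fin s′ (λ n e → inf n (trans (rest (replicate n 1)) e))

EFO⇒arrow : ∀ π T q → EFO π T q → T [] ≡ just arrow
EFO⇒arrow neg T []                (isArrow , _) = isArrow
EFO⇒arrow pos T (suc zero ∷ q)    (isArrow , _) = isArrow
EFO⇒arrow neg T (suc zero ∷ q)    (isArrow , _) = isArrow
EFO⇒arrow pos T (suc (suc k) ∷ q) (isArrow , _) = isArrow
EFO⇒arrow neg T (suc (suc k) ∷ q) (isArrow , _) = isArrow

padded : Pos → ℕ → ℕ
padded []      i       = 0
padded (c ∷ p) zero    = c
padded (c ∷ p) (suc i) = padded p i

padded-beyond : ∀ p {i} → length p ≤ i → padded p i ≡ 0
padded-beyond []      _         = refl
padded-beyond (c ∷ p) (s≤s le) = padded-beyond p le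

prefix-padded : ∀ n p → Σ ℕ λ a → Σ Pos λ rest → prefix (padded p) n ++ rest ≡ p ++ replicate a 0
prefix-padded zero    p       = 0 , p ++ [] , refl
prefix-padded (suc n) []      with prefix-padded n []
... | a , rest , e = suc a , rest , cong (0 ∷_) e
prefix-padded (suc n) (c ∷ p) with prefix-padded n p
... | a , rest , e = a , rest , cong (c ∷_) e

data BelowView (p : Pos) : Pos → Set where
  below : ∀ r → BelowView p (p ++ r)
  apart : ∀ {r} → (∀ r′ → r ≢ p ++ r′) → BelowView p r

belowView : ∀ p r → BelowView p r
belowView []      r       = below r
belowView (a ∷ p) []      = apart (λ _ ())
belowView (a ∷ p) (b ∷ r) with a ≟ b | belowView p r
... | no a≢b   | _         = apart (λ _ e → a≢b (sym (∷-injectiveˡ e)))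
... | yes refl | below r′  = below r′
... | yes refl | apart ne  = apart (λ r′ e → ne r′ (∷-injectiveʳ e))

initLast-∷ʳ : ∀ {A : Set} (xs : List A) x → initLast (xs ∷ʳ x) ≡ xs ∷ʳ′ x
initLast-∷ʳ []       x = refl
initLast-∷ʳ (y ∷ xs) x rewrite initLast-∷ʳ xs x = refl

module _ (t : Term) where

  sub-root : ∀ p → sub (tree t) p [] ≡ tree t p
  sub-root p = cong (tree t) (++-identityʳ p)

  sub-child : ∀ p c → sub (tree t) (p · c) ≈ sub (sub (tree t) p) (c ∷ [])
  sub-child p c q = cong (tree t) (++-assoc p (c ∷ []) q)

  support-gap : ∀ p → tree t p ≡ nothing → ∀ q → tree t (p ++ q) ≡ nothing
  support-gap p e []      = trans (sub-root p) e
  support-gap p e (k ∷ q) = trans (cong (tree t) (sym (++-assoc p (k ∷ []) q))) (support-gap (p · k) (closed t p k e) q)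

  support-prefix : ∀ p q → tree t (p ++ q) ≢ nothing → tree t p ≢ nothing
  support-prefix p q ne e = ne (support-gap p e q)

  Λ001-no-trailing-zeros : InΛ001 t → ∀ p → ¬ (∀ a → tree t (p ++ replicate a 0) ≢ nothing)
  Λ001-no-trailing-zeros λ001 p zeros with λ001 (padded p) onBranch (length p)
    where
    onBranch : ∀ n → tree t (prefix (padded p) n) ≢ nothing
    onBranch n with prefix-padded n p
    ... | a , rest , e = support-prefix (prefix (padded p) n) rest (subst (λ r → tree t r ≢ nothing) (sym e) (zeros a))
  ... | m , beyond , two with () ← trans (sym (padded-beyond p beyond)) two

  -- FreeOcc x p r: the occurrence of x at r is free in the subterm at p (positions are taken in t)
  data FreeOcc (x : ℕ) : Pos → Pos → Set where
    here   : ∀ {p} → tree t p ≡ just (var x) → FreeOcc x p p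
    inBody : ∀ {p y r} → tree t p ≡ just (lam y) → y ≢ x → FreeOcc x (p · 0) r → FreeOcc x p r
    inApp  : ∀ {p c r} → tree t p ≡ just app → FreeOcc x (p · c) r → FreeOcc x p r

  module _ {x : ℕ} where

    freeOcc-support : ∀ {p r} → FreeOcc x p r → tree t p ≢ nothing
    freeOcc-support (here e)       e′ = just≢nothing (trans (sym e) e′)
    freeOcc-support (inBody e _ _) e′ = just≢nothing (trans (sym e) e′)
    freeOcc-support (inApp e _)    e′ = just≢nothing (trans (sym e) e′)

    freeOcc-var : ∀ {p r} → FreeOcc x p r → tree t r ≡ just (var x)
    freeOcc-var (here e)       = e
    freeOcc-var (inBody _ _ o) = freeOcc-var o
    freeOcc-var (inApp _ o)    = freeOcc-var o

    freeOcc-below : ∀ {p r} → FreeOcc x p r → ∃ λ s → r ≡ p ++ s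
    freeOcc-below {p} (here _) = [] , sym (++-identityʳ p)
    freeOcc-below {p} (inBody _ _ o) with freeOcc-below o
    ... | s , refl = 0 ∷ s , ++-assoc p (0 ∷ []) s
    freeOcc-below {p} (inApp {c = c} _ o) with freeOcc-below o
    ... | s , refl = c ∷ s , ++-assoc p (c ∷ []) s

    freeOcc-child : ∀ {p c r} → FreeOcc x (p · c) (p ++ r) → ∃ λ s → r ≡ c ∷ s
    freeOcc-child {p} {c} {r} o with freeOcc-below o
    ... | s , e = s , ++-cancelˡ p r (c ∷ s) (trans e (++-assoc p (c ∷ []) s))

    freeOcc-at-var : ∀ {p y r} → tree t p ≡ just (var y) → FreeOcc x p r → r ≡ p × x ≡ y
    freeOcc-at-var e (here e′)       with refl ← trans (sym e) e′ = refl , refl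
    freeOcc-at-var e (inBody e′ _ _) with () ← trans (sym e) e′
    freeOcc-at-var e (inApp e′ _)    with () ← trans (sym e) e′

    freeOcc-at-lam : ∀ {p y r} → tree t p ≡ just (lam y) → FreeOcc x p r → y ≢ x × FreeOcc x (p · 0) r
    freeOcc-at-lam e (here e′)        with () ← trans (sym e) e′
    freeOcc-at-lam e (inBody e′ ne o) with refl ← trans (sym e) e′ = ne , o
    freeOcc-at-lam e (inApp e′ _)     with () ← trans (sym e) e′

    freeOcc-at-app : ∀ {p r} → tree t p ≡ just app → FreeOcc x p r → ∃ λ c → FreeOcc x (p · c) r
    freeOcc-at-app e (here e′)       with () ← trans (sym e) e′
    freeOcc-at-app e (inBody e′ _ _) with () ← trans (sym e) e′
    freeOcc-at-app e (inApp _ o)     = _ , o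

  freeOcc-child-unique : ∀ {x y p i j r} → FreeOcc x (p · i) r → FreeOcc y (p · j) r → i ≡ j
  freeOcc-child-unique {p = p} {i} o o′ with freeOcc-below o
  ... | s , refl with freeOcc-child (subst (FreeOcc _ _) (++-assoc p (i ∷ []) s) o′)
  ...   | _ , e = ∷-injectiveˡ e

  freeOccBelow? : ∀ x p r → Dec (FreeOcc x p (p ++ r))
  freeOccBelow? x p r with tree t p in e
  ... | nothing        = no λ o → freeOcc-support o e
  freeOccBelow? x p [] | just (var y) with y ≟ x
  ... | yes refl = yes (subst (FreeOcc x p) (sym (++-identityʳ p)) (here e))
  ... | no y≢x   = no λ o → y≢x (sym (proj₂ (freeOcc-at-var e o)))
  freeOccBelow? x p (c ∷ r) | just (var y) =
    no λ o → case (++-identityʳ-unique p (sym (proj₁ (freeOcc-at-var e o))))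
    where case : c ∷ r ≢ []
          case ()
  freeOccBelow? x p [] | just (lam y) =
    no λ o → case (freeOcc-child (proj₂ (freeOcc-at-lam e o)))
    where case : ¬ ∃ λ s → [] ≡ 0 ∷ s
          case (_ , ())
  freeOccBelow? x p (c ∷ r) | just (lam y) with y ≟ x | c
  ... | yes refl | _     = no λ o → proj₁ (freeOcc-at-lam e o) refl
  ... | no y≢x   | suc c = no λ o → case (freeOcc-child (proj₂ (freeOcc-at-lam e o)))
    where case : ¬ ∃ λ s → suc c ∷ r ≡ 0 ∷ s
          case (_ , ())
  ... | no y≢x   | zero  =
    map′ (λ o → inBody e y≢x (subst (FreeOcc x (p · 0)) (++-assoc p (0 ∷ []) r) o))
         (λ o → subst (FreeOcc x (p · 0)) (sym (++-assoc p (0 ∷ []) r)) (proj₂ (freeOcc-at-lam e o)))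
         (freeOccBelow? x (p · 0) r)
  freeOccBelow? x p [] | just app =
    no λ o → case (freeOcc-at-app e o)
    where case : ¬ ∃ λ c → FreeOcc x (p · c) (p ++ [])
          case (_ , o) with freeOcc-child o
          ... | _ , ()
  freeOccBelow? x p (c ∷ r) | just app =
    map′ (λ o → inApp e (subst (FreeOcc x (p · c)) (++-assoc p (c ∷ []) r) o))
         (λ o → subst (FreeOcc x (p · c)) (sym (++-assoc p (c ∷ []) r)) (atChild (freeOcc-at-app e o)))
         (freeOccBelow? x (p · c) r)
    where
    atChild : (∃ λ c′ → FreeOcc x (p · c′) (p ++ c ∷ r)) → FreeOcc x (p · c) (p ++ c ∷ r)
    atChild (c′ , o) with freeOcc-child o
    ... | _ , refl = o

  freeOcc? : ∀ x p r → Dec (FreeOcc x p r)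
  freeOcc? x p r with belowView p r
  ... | below r′ = freeOccBelow? x p r′
  ... | apart ne = no λ o → ne _ (proj₂ (freeOcc-below o))

  -- The types of subterms

  appWithFunctionAt : Pos → ℕ → Maybe TmLabel → Maybe Pos
  appWithFunctionAt s (suc zero) (just app) = just s
  appWithFunctionAt _ _          _          = nothing

  appOf : Pos → Maybe Pos
  appOf p with initLast p
  ... | []      = nothing
  ... | s ∷ʳ′ k = appWithFunctionAt s k (tree t s)

  appOf-child : ∀ s k → appOf (s · k) ≡ appWithFunctionAt s k (tree t s)
  appOf-child s k rewrite initLast-∷ʳ s k = refl

  appOf-just : ∀ {p s} → appOf p ≡ just s → p ≡ s · 1 × tree t s ≡ just app
  appOf-just {p} e with initLast p
  ... | s ∷ʳ′ k with tree t s in eT | k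
  ...   | just app | suc zero with refl ← e = refl , eT

  data Kind : Set where
    binder   : ℕ → Kind
    operator : Pos → Kind
    atomic   : Kind

  kindOf : Maybe TmLabel → Maybe Pos → Kind
  kindOf (just (lam x)) _ = binder x
  kindOf _              m = maybe′ operator atomic m

  kind : Pos → Kind
  kind p = kindOf (tree t p) (appOf p)

  NotLam : Pos → Set
  NotLam p = ∀ x → tree t p ≢ just (lam x)

  var-notLam : ∀ {p x} → tree t p ≡ just (var x) → NotLam p
  var-notLam e y e′ with () ← trans (sym e) e′

  app-notLam : ∀ {p} → tree t p ≡ just app → NotLam p
  app-notLam e y e′ with () ← trans (sym e) e′

  kind-lam : ∀ {p x} → tree t p ≡ just (lam x) → kind p ≡ binder x
  kind-lam {p} e = cong (λ m → kindOf m (appOf p)) e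

  kind-notLam : ∀ {p} → NotLam p → kind p ≡ maybe′ operator atomic (appOf p)
  kind-notLam {p} notLam with tree t p
  ... | nothing      = refl
  ... | just (var _) = refl
  ... | just app     = refl
  ... | just (lam x) = ⊥-elim (notLam x refl)

  kindOf-binder : ∀ m a {x} → kindOf m a ≡ binder x → m ≡ just (lam x)
  kindOf-binder (just (lam _)) _ refl = refl
  kindOf-binder (just (var _)) (just _) ()
  kindOf-binder (just app)     (just _) ()
  kindOf-binder nothing        (just _) ()

  kindOf-operator : ∀ m a {s} → kindOf m a ≡ operator s → a ≡ just s
  kindOf-operator (just (var _)) (just _) refl = refl
  kindOf-operator (just app)     (just _) refl = refl
  kindOf-operator nothing        (just _) refl = refl

  kind-binder : ∀ {p x} → kind p ≡ binder x → tree t p ≡ just (lam x)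
  kind-binder {p} = kindOf-binder (tree t p) (appOf p)

  kind-operator : ∀ {p s} → kind p ≡ operator s → appOf p ≡ just s
  kind-operator {p} = kindOf-operator (tree t p) (appOf p)

  labelOf : Kind → TyLabel
  labelOf atomic = atom 0
  labelOf _      = arrow

  stepOf : Pos → Kind → ℕ → Maybe Pos
  stepOf p (binder x)   (suc zero)       = just (p · 0)
  stepOf p (binder x)   k                = select (freeOcc? x (p · 0)) k
  stepOf p (operator s) (suc zero)       = just s
  stepOf p (operator s) (suc (suc zero)) = just (s · 2)
  stepOf p (operator s) _                = nothing
  stepOf p atomic       _                = nothing

  tyStep : Pos → ℕ → Maybe Pos
  tyStep p = stepOf p (kind p)

  open Unfold (λ p → labelOf (kind p)) tyStep

  stepOf-zero : ∀ p κ → stepOf p κ 0 ≡ nothing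
  stepOf-zero p (binder x)   = refl
  stepOf-zero p (operator s) = refl
  stepOf-zero p atomic       = refl

  stepOf-atom : ∀ p κ k {a} → labelOf κ ≡ atom a → stepOf p κ k ≡ nothing
  stepOf-atom p atomic k _ = refl

  stepOf-arrow : ∀ p κ → labelOf κ ≡ arrow → stepOf p κ 1 ≢ nothing
  stepOf-arrow p (binder x)   _ ()
  stepOf-arrow p (operator s) _ ()

  tyStep-kind : ∀ {p κ} → kind p ≡ κ → ∀ k → tyStep p k ≡ stepOf p κ k
  tyStep-kind {p} e k = cong (λ κ → stepOf p κ k) e

  atomic-no-infinite1Branch : ∀ {p} → kind p ≡ atomic → ¬ Infinite1Branch p
  atomic-no-infinite1Branch {p} e inf with infinite1Branch-step p inf
  ... | _ , step , _ with () ← trans (sym (tyStep-kind e 1)) step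

  infinite1Branch-reaches-binder : ∀ n p → length p ≡ n → Infinite1Branch p → ∃₂ λ q x → kind q ≡ binder x × Infinite1Branch q
  infinite1Branch-reaches-binder n p len inf with kind p in e
  ... | binder x   = p , x , e , inf
  ... | atomic     = ⊥-elim (atomic-no-infinite1Branch e inf)
  ... | operator s with infinite1Branch-step p inf | appOf-just {p} (kind-operator {p} e)
  ...   | p′ , step , inf′ | refl , _ with refl ← trans (sym (tyStep-kind e 1)) step with n
  ...     | zero  with () ← trans (sym (length-· s 1)) len
  ...     | suc n = infinite1Branch-reaches-binder n s (suc-injective (trans (sym (length-· s 1)) len)) inf′

  binder-body : ∀ {q x} → kind q ≡ binder x → Infinite1Branch q → ∃ λ y → kind (q · 0) ≡ binder y × Infinite1Branch (q · 0)
  binder-body {q} e inf with infinite1Branch-step q inf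
  ... | p′ , step , inf′ with refl ← trans (sym (tyStep-kind e 1)) step with kind (q · 0) in e′
  ...   | binder y   = y , refl , inf′
  ...   | atomic     = ⊥-elim (atomic-no-infinite1Branch e′ inf′)
  ...   | operator s with () ← trans (sym (appOf-child q 0)) (kind-operator e′)

  binder-zeros-in-support : ∀ a {q x} → kind q ≡ binder x → Infinite1Branch q → tree t (q ++ replicate a 0) ≢ nothing
  binder-zeros-in-support zero    {q} e inf = subst (λ r → tree t r ≢ nothing) (sym (++-identityʳ q))
                                         (λ e′ → just≢nothing (trans (sym (kind-binder e)) e′))
  binder-zeros-in-support (suc a) {q} e inf with binder-body e inf
  ... | _ , e′ , inf′ = subst (λ r → tree t r ≢ nothing) (++-assoc q (0 ∷ []) (replicate a 0)) (binder-zeros-in-support a e′ inf′)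

  no-infinite1Branch : InΛ001 t → ∀ p → ¬ Infinite1Branch p
  no-infinite1Branch λ001 p inf with infinite1Branch-reaches-binder _ p refl inf
  ... | q , _ , e , infq = Λ001-no-trailing-zeros λ001 q (λ a → binder-zeros-in-support a e infq)

  unfold-atomLeaf : ∀ p q a k → unfold p q ≡ just (atom a) → unfold p (q · k) ≡ nothing
  unfold-atomLeaf p q a k e with unfold-local p q e
  ... | s , label , child = trans (child k) (cong (λ m → unfoldFrom m []) (stepOf-atom s (kind s) k label))

  unfold-arrowTgt : ∀ p q → unfold p q ≡ just arrow → unfold p (q · 1) ≢ nothing
  unfold-arrowTgt p q e with unfold-local p q e
  ... | s , label , child = λ e′ → rooted (tyStep s 1) (stepOf-arrow s (kind s) label) (trans (sym (child 1)) e′)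
    where
    rooted : ∀ m → m ≢ nothing → unfoldFrom m [] ≢ nothing
    rooted nothing  ne = ⊥-elim (ne refl)
    rooted (just _) _  = just≢nothing

  unfold-arrowNo0 : ∀ p q → unfold p q ≡ just arrow → unfold p (q · 0) ≡ nothing
  unfold-arrowNo0 p q e with unfold-local p q e
  ... | s , _ , child = trans (child 0) (cong (λ m → unfoldFrom m []) (stepOf-zero s (kind s)))

  tyAt : InΛ001 t → Pos → Ty
  tyAt λ001 p = record
    { tree     = unfold p
    ; root     = just≢nothing
    ; closed   = λ q k e → unfold-gap p q e (k ∷ [])
    ; atomLeaf = unfold-atomLeaf p
    ; arrowTgt = unfold-arrowTgt p
    ; arrowNo0 = unfold-arrowNo0 p
    ; no1ω     = unfold-no1ω (no-infinite1Branch λ001) p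
    }

  EFO-unfoldFrom : ∀ π m q → EFO π (unfoldFrom m) q → Σ Pos λ s → m ≡ just s × EFO π (unfold s) q
  EFO-unfoldFrom π nothing  q efo with () ← EFO⇒arrow π _ q efo
  EFO-unfoldFrom π (just s) q efo = s , refl , efo

  atomic-no-EFO : ∀ {p} → kind p ≡ atomic → ∀ π q → ¬ EFO π (unfold p) q
  atomic-no-EFO e π q efo with () ← trans (cong (just ∘ labelOf) (sym e)) (EFO⇒arrow π _ q efo)

  no-EFO⁺ : ∀ p → appOf p ≡ nothing → ∀ q → ¬ EFO pos (unfold p) q
  no-EFO⁻ : ∀ p → NotLam p → ∀ q → ¬ EFO neg (unfold p) q

  no-EFO⁺ p noApp (suc k ∷ q) efo with kind p in e
  ... | atomic     = atomic-no-EFO e pos (suc k ∷ q) efo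
  ... | operator s with () ← trans (sym noApp) (kind-operator {p} e)
  no-EFO⁺ p noApp (suc zero ∷ q) (_ , efo) | binder x with EFO-unfoldFrom pos (tyStep p 1) q efo
  ... | s , step , efo′ with refl ← trans (sym (tyStep-kind e 1)) step = no-EFO⁺ (p · 0) (appOf-child p 0) q efo′
  no-EFO⁺ p noApp (suc (suc k) ∷ q) (_ , efo) | binder x with EFO-unfoldFrom neg (tyStep p (suc (suc k))) q efo
  ... | s , step , efo′ with select-just (freeOcc? x (p · 0)) (suc (suc k)) (trans (sym (tyStep-kind e (suc (suc k)))) step)
  ...   | occ , _ = no-EFO⁻ s (var-notLam (freeOcc-var occ)) q efo′

  no-EFO⁻ p notLam q efo with appOf p in eApp
  ... | nothing = atomic-no-EFO (trans (kind-notLam notLam) (cong (maybe′ operator atomic) eApp)) neg q efo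
  ... | just s  = operator-no-EFO⁻ q efo
    where
    e : kind p ≡ operator s
    e = trans (kind-notLam notLam) (cong (maybe′ operator atomic) eApp)
    operator-no-EFO⁻ : ∀ q → ¬ EFO neg (unfold p) q
    operator-no-EFO⁻ [] (_ , noSource)
      with () ← trans (cong (λ m → unfoldFrom m []) (sym (tyStep-kind e 2))) (noSource 2 (s≤s (s≤s z≤n)))
    operator-no-EFO⁻ (suc zero ∷ q) (_ , efo) with EFO-unfoldFrom neg (tyStep p 1) q efo
    ... | s′ , step , efo′ with refl ← trans (sym (tyStep-kind e 1)) step =
      no-EFO⁻ s (app-notLam (proj₂ (appOf-just {p} eApp))) q efo′
    operator-no-EFO⁻ (suc (suc zero) ∷ q) (_ , efo) with EFO-unfoldFrom pos (tyStep p 2) q efo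
    ... | s′ , step , efo′ with refl ← trans (sym (tyStep-kind e 2)) step = no-EFO⁺ (s · 2) (appOf-child s 2) q efo′
    operator-no-EFO⁻ (suc (suc (suc k)) ∷ q) (_ , efo) with EFO-unfoldFrom pos (tyStep p (suc (suc (suc k)))) q efo
    ... | s′ , step , _ with () ← trans (sym (tyStep-kind e (suc (suc (suc k))))) step

  -- The derivation

  module _ (λ001 : InΛ001 t) where

    ctxAt : Pos → Ctx
    ctxAt p x = record { comp = λ j → Maybe.map (tyAt λ001) (select (freeOcc? x p) j) ; comp0 = refl ; comp1 = refl }

    judgmentAt : Pos → Judg
    judgmentAt p = ctxAt p ⊢ sub (tree t) p ∶ tyAt λ001 p

    nodeAt : Pos → Maybe Judg
    nodeAt p = Maybe.map (λ _ → judgmentAt p) (tree t p)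

    nodeAt-support : ∀ {p} → tree t p ≢ nothing → nodeAt p ≡ just (judgmentAt p)
    nodeAt-support {p} ne with tree t p
    ... | nothing = ⊥-elim (ne refl)
    ... | just _  = refl

    nodeAt-gap : ∀ {p} → tree t p ≡ nothing → nodeAt p ≡ nothing
    nodeAt-gap {p} e = cong (Maybe.map (λ _ → judgmentAt p)) e

    nodeAt-nothing : ∀ {p} → nodeAt p ≡ nothing → tree t p ≡ nothing
    nodeAt-nothing {p} e with tree t p
    ... | nothing = refl

    nodeAt-just : ∀ {p J} → nodeAt p ≡ just J → J ≡ judgmentAt p × tree t p ≢ nothing
    nodeAt-just {p} e with tree t p
    nodeAt-just refl | just _ = refl , λ ()

    compIs-tyStep : ∀ p k {m} → tyStep p k ≡ m → CompIs (unfold p) k (Maybe.map (tyAt λ001) m)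
    compIs-tyStep p k {nothing} e   = cong (λ m → unfoldFrom m []) e
    compIs-tyStep p k {just r}  e q = cong (λ m → unfoldFrom m q) e

    axAt : ∀ p x → tree t p ≡ just (var x) → AxRule nodeAt p (judgmentAt p)
    axAt p x e = x , trans (sub-root p) e , (suc (suc (encode p)) , s≤s (s≤s z≤n) , single)
               , others , λ k → nodeAt-gap (varLeaf t p x k e)
      where
      single : IsSingle (suc (suc (encode p))) (tyAt λ001 p) (ctxAt p x)
      single j = ≈M-reflexive (selected j)
        where
        selected : ∀ j → Maybe.map (tyAt λ001) (select (freeOcc? x p) j)
                         ≡ (if ⌊ j ≟ suc (suc (encode p)) ⌋ then just (tyAt λ001 p) else nothing)
        selected j with j ≟ suc (suc (encode p))
        ... | yes refl = cong (Maybe.map (tyAt λ001)) (select-encode (freeOcc? x p) (here e))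
        ... | no j≢    with select (freeOcc? x p) j in sel
        ...   | nothing = refl
        ...   | just r with select-just (freeOcc? x p) j sel
        ...     | occ , refl with refl ← proj₁ (freeOcc-at-var e occ) = ⊥-elim (j≢ refl)
      others : ∀ y → y ≢ x → ctxAt p y ≈S emptySeq
      others y y≢x j = ≈M-reflexive (cong (Maybe.map (tyAt λ001))
        (select-none (freeOcc? y p) (λ occ → y≢x (proj₂ (freeOcc-at-var e occ))) j))

    absAt : ∀ p x → tree t p ≡ just (lam x) → AbsRule nodeAt p (judgmentAt p)
    absAt p x e = x , trans (sub-root p) e
                , (judgmentAt (p · 0) , nodeAt-support (lamBody t p x e) , sub-child p 0 , bodyCtx , arrowType)
                , λ k k≢0 → nodeAt-gap (lamOnly t p x k e k≢0)
      where
      bodyCtx : ctxAt p ≈C (ctxAt (p · 0) - x)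
      bodyCtx y j with y ≟ x
      ... | yes refl = ≈M-reflexive (cong (Maybe.map (tyAt λ001))
                         (select-none (freeOcc? x p) (λ occ → proj₁ (freeOcc-at-lam e occ) refl) j))
      ... | no y≢x   = ≈M-reflexive (cong (Maybe.map (tyAt λ001))
                         (select-cong (freeOcc? y p) (freeOcc? y (p · 0))
                           (λ occ → proj₂ (freeOcc-at-lam e occ)) (inBody e (λ x≡y → y≢x (sym x≡y))) j))
      arrowType : IsArrow (ctxAt (p · 0) x) (tyAt λ001 (p · 0)) (tyAt λ001 p)
      arrowType = cong (just ∘ labelOf) (kind-lam e)
                , (λ q → cong (λ m → unfoldFrom m q) (tyStep-kind (kind-lam e) 1))
                , λ { (suc (suc k)) _ → compIs-tyStep p (suc (suc k)) (tyStep-kind (kind-lam e) (suc (suc k)))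
                    ; (suc zero) (s≤s ()) }

    ctxAt-children-disjoint : ∀ p {i i′} → i ≢ i′ → ∀ x j →
                              comp (ctxAt (p · i) x) j ≡ nothing ⊎ comp (ctxAt (p · i′) x) j ≡ nothing
    ctxAt-children-disjoint p {i} {i′} i≢i′ x j
      with select (freeOcc? x (p · i)) j in sel | select (freeOcc? x (p · i′)) j in sel′
    ... | nothing | _       = inj₁ refl
    ... | just r  | nothing = inj₂ refl
    ... | just r  | just r′ with select-just (freeOcc? x (p · i)) j sel | select-just (freeOcc? x (p · i′)) j sel′
    ...   | occ , idx | occ′ , idx′ with refl ← encode-injective (suc-injective (suc-injective (trans (sym idx) idx′))) =
      ⊥-elim (i≢i′ (freeOcc-child-unique occ occ′))

    appAt-disjoint : ∀ p → PremisesDisjoint nodeAt p (judgmentAt p)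
    appAt-disjoint p i i′ Ji Ji′ i≢i′ node node′ with nodeAt-just node | nodeAt-just node′
    ... | refl , _ | refl , _ = ctxAt-children-disjoint p i≢i′

    appAt-join : ∀ p → tree t p ≡ just app → IsJoinOfPremises nodeAt p (judgmentAt p)
    appAt-join p e x j = fromPremise , toPremise
      where
      fromPremise : ∀ i Ji → nodeAt (p · i) ≡ just Ji → comp (ctx Ji x) j ≢ nothing →
                    comp (ctxAt p x) j ≈M comp (ctx Ji x) j
      fromPremise i Ji node ne with nodeAt-just node
      ... | refl , _ with map-just (select (freeOcc? x (p · i)) j) ne
      ...   | r , sel = ≈M-reflexive (cong (Maybe.map (tyAt λ001)) (trans
                          (select-transfer (freeOcc? x (p · i)) (freeOcc? x p) j sel
                             (inApp e (proj₁ (select-just (freeOcc? x (p · i)) j sel))))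
                          (sym sel)))
      toPremise : comp (ctxAt p x) j ≢ nothing →
                  Σ ℕ λ i → Σ Judg λ Ji → nodeAt (p · i) ≡ just Ji × comp (ctx Ji x) j ≢ nothing
      toPremise ne with map-just (select (freeOcc? x p) j) ne
      ... | r , sel with freeOcc-at-app e (proj₁ (select-just (freeOcc? x p) j sel))
      ...   | c , occ = c , judgmentAt (p · c) , nodeAt-support (freeOcc-support occ)
                      , λ e′ → just≢nothing (trans (cong (Maybe.map (tyAt λ001))
                                 (sym (select-transfer (freeOcc? x p) (freeOcc? x (p · c)) j sel occ))) e′)

    appAt : IsNormal t → ∀ p → tree t p ≡ just app → AppRule nodeAt p (judgmentAt p)
    appAt nf p e = trans (sub-root p) e
                 , ( judgmentAt (p · 1) , nodeAt-support (appFun t p e) , sub-child p 1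
                   , cong (just ∘ labelOf) functionKind
                   , (λ q → cong (λ m → unfoldFrom m q) (tyStep-kind functionKind 1))
                   , argument)
                 , nodeAt-gap (appOnly t p 0 e (λ ()) (λ ()))
                 , appAt-disjoint p
                 , appAt-join p e
      where
      functionKind : kind (p · 1) ≡ operator p
      functionKind = trans (kind-notLam (λ y → nf p y e))
                           (cong (maybe′ operator atomic) (trans (appOf-child p 1) (cong (appWithFunctionAt p 1) e)))
      argument : ∀ k → 2 ≤ k → ArgPremise nodeAt p (judgmentAt p) (tyAt λ001 (p · 1)) k
      argument (suc zero) (s≤s ())
      argument (suc (suc zero)) _ =
        inj₂ ( judgmentAt (p · 2) , nodeAt-support (appArg t p e) , sub-child p 2
             , λ q → cong (λ m → unfoldFrom m q) (tyStep-kind functionKind 2))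
      argument (suc (suc (suc k))) _ =
        inj₁ ( cong (λ m → unfoldFrom m []) (tyStep-kind functionKind (suc (suc (suc k))))
             , nodeAt-gap (appOnly t p (suc (suc (suc k))) e (λ ()) (λ ())))

    nodeAt-rule : IsNormal t → ∀ p J → nodeAt p ≡ just J → Rule nodeAt p J
    nodeAt-rule nf p J node with nodeAt-just node | tree t p in e
    ... | refl , ne | nothing      = ⊥-elim (ne e)
    ... | refl , _  | just (var x) = inj₁ (axAt p x e)
    ... | refl , _  | just (lam x) = inj₂ (inj₁ (absAt p x e))
    ... | refl , _  | just app     = inj₂ (inj₂ (appAt nf p e))

    derivation : IsNormal t → Deriv
    derivation nf = record
      { node   = nodeAt
      ; root   = λ e → just≢nothing (trans (sym (nodeAt-support (root t))) e)
      ; closed = λ p k e → nodeAt-gap (closed t p k (nodeAt-nothing e))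
      ; rule   = nodeAt-rule nf
      }

    derivation-unforgetful : (nf : IsNormal t) → Unforgetful (derivation nf) t
    derivation-unforgetful nf = judgmentAt [] , nodeAt-support (root t) , (λ q → refl)
                              , contexts , no-EFO⁺ [] refl
      where
      contexts : ∀ x → EFOnegEmptySeq (ctxAt [] x)
      contexts x k S e with select (freeOcc? x []) k in sel
      contexts x k .(tyAt λ001 r) refl | just r =
        no-EFO⁻ r (var-notLam (freeOcc-var (proj₁ (select-just (freeOcc? x []) k sel))))

proposition7 : (t : Term) → IsNormal t → InΛ001 t → Σ Deriv λ P → Unforgetful P t
proposition7 t nf λ001 = derivation t λ001 nf , derivation-unforgetful t λ001 nf
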